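{- Let $m,n$ be nonnegative integers. (1) Suppose $(x,y,z,t)$ are integers with $m=x^{2}+y^{2}+z^{2}+t^{2}$ and $n=x+3y$, and at least one of $y-z+t$, $y+z-t$, $y+z+t$, $y-z-t$ is divisible by $3$. Then there exist integers $x',y',z',t'$ with $m=x'^{2}+y'^{2}+z'^{2}+t'^{2}$ and $n=x'+y'+2z'+2t'$. (2) Suppose $(x,y,z,t)$ are integers with $m=x^{2}+y^{2}+z^{2}+t^{2}$ and $n=2x+3y$, and at least one of $y-z+t$, $y+z-t$, $y+z+t$, $y-z-t$ is divisible by $3$. Then there exist integers $x',y',z',t'$ with $m=x'^{2}+y'^{2}+z'^{2}+t'^{2}$ and $n=x'+2y'+2z'+2t'$. -}

module Defs where

open import Data.Integer using (ℤ; _+_; _-_; _*_)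

sq4 : ℤ → ℤ → ℤ → ℤ → ℤ
sq4 x y z t = x * x + y * y + z * z + t * t

{-# OPTIONS --safe #-}
module Submission where

-- Changing the signs of z and t changes neither the sum of squares nor n = x + 3y
-- (resp. 2x + 3y), so we may assume 3 ∣ y - z - t, i.e. y = 3k + z + t. Then
-- (x, k + z + t, z + 2k, t + 2k), resp. (z + t + k, x, t + 2k, z + 2k), is the
-- required representation, as one checks by expanding once y is eliminated.

open import Defs
open import Data.Nat using (ℕ)
open import Data.Integer using (ℤ; +_; _+_; _-_; _*_; -_)
open import Data.Integer.Divisibility using (_∣_)
open import Data.Integer.Divisibility.Signed using (divides; ∣ᵤ⇒∣)
open import Data.Integer.Tactic.RingSolver using (solve-∀)
open import Data.Product using (_×_; ∃-syntax; _,_)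
open import Data.Sum using (_⊎_; inj₁; inj₂)
open import Relation.Binary.PropositionalEquality
  using (_≡_; refl; sym; trans; cong; cong₂; subst; subst₂)

FourSquaresWith : (ℤ → ℤ → ℤ → ℤ → ℤ) → ℤ → ℤ → Set
FourSquaresWith f m n = ∃[ x ] ∃[ y ] ∃[ z ] ∃[ t ] (m ≡ sq4 x y z t × n ≡ f x y z t)

form₁₁₂₂ form₁₂₂₂ : ℤ → ℤ → ℤ → ℤ → ℤ
form₁₁₂₂ x y z t = x + y + + 2 * z + + 2 * t
form₁₂₂₂ x y z t = x + + 2 * y + + 2 * z + + 2 * t

neg-square : ∀ i → - i * - i ≡ i * i
neg-square = solve-∀

3∣y-z-t⇒y≡k*3+z+t : ∀ y z t → + 3 ∣ y - z - t → ∃[ k ] y ≡ k * + 3 + z + t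
3∣y-z-t⇒y≡k*3+z+t y z t 3∣ with ∣ᵤ⇒∣ {i = y - z - t} 3∣
... | divides k y-z-t≡k*3 = k , trans (y≡y-z-t+z+t y z t) (cong (λ w → w + z + t) y-z-t≡k*3)
  where
  y≡y-z-t+z+t : ∀ y z t → y ≡ y - z - t + z + t
  y≡y-z-t+z+t = solve-∀

3∣signed-sum⇒3∣y-z′-t′ : ∀ y z t →
  (+ 3 ∣ y - z + t) ⊎ (+ 3 ∣ y + z - t) ⊎ (+ 3 ∣ y + z + t) ⊎ (+ 3 ∣ y - z - t) →
  ∃[ z′ ] ∃[ t′ ] (z′ * z′ ≡ z * z × t′ * t′ ≡ t * t × + 3 ∣ y - z′ - t′)
3∣signed-sum⇒3∣y-z′-t′ y z t (inj₁ 3∣) =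
  z , - t , refl , neg-square t , subst (+ 3 ∣_) (y-z+t≡y-z-[-t] y z t) 3∣
  where
  y-z+t≡y-z-[-t] : ∀ y z t → y - z + t ≡ y - z - - t
  y-z+t≡y-z-[-t] = solve-∀
3∣signed-sum⇒3∣y-z′-t′ y z t (inj₂ (inj₁ 3∣)) =
  - z , t , neg-square z , refl , subst (+ 3 ∣_) (y+z-t≡y-[-z]-t y z t) 3∣
  where
  y+z-t≡y-[-z]-t : ∀ y z t → y + z - t ≡ y - - z - t
  y+z-t≡y-[-z]-t = solve-∀
3∣signed-sum⇒3∣y-z′-t′ y z t (inj₂ (inj₂ (inj₁ 3∣))) =
  - z , - t , neg-square z , neg-square t , subst (+ 3 ∣_) (y+z+t≡y-[-z]-[-t] y z t) 3∣
  where
  y+z+t≡y-[-z]-[-t] : ∀ y z t → y + z + t ≡ y - - z - - t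
  y+z+t≡y-[-z]-[-t] = solve-∀
3∣signed-sum⇒3∣y-z′-t′ _ z t (inj₂ (inj₂ (inj₂ 3∣))) = z , t , refl , refl , 3∣

x+3y-as-form₁₁₂₂ : ∀ x y z t → + 3 ∣ y - z - t →
  FourSquaresWith form₁₁₂₂ (sq4 x y z t) (x + + 3 * y)
x+3y-as-form₁₁₂₂ x y z t 3∣ with 3∣y-z-t⇒y≡k*3+z+t y z t 3∣
... | k , refl = x , k + z + t , z + + 2 * k , t + + 2 * k , squares x z t k , linear x z t k
  where
  squares : ∀ x z t k →
    x * x + (k * + 3 + z + t) * (k * + 3 + z + t) + z * z + t * t ≡
    x * x + (k + z + t) * (k + z + t) + (z + + 2 * k) * (z + + 2 * k) + (t + + 2 * k) * (t + + 2 * k)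
  squares = solve-∀
  linear : ∀ x z t k →
    x + + 3 * (k * + 3 + z + t) ≡ x + (k + z + t) + + 2 * (z + + 2 * k) + + 2 * (t + + 2 * k)
  linear = solve-∀

2x+3y-as-form₁₂₂₂ : ∀ x y z t → + 3 ∣ y - z - t →
  FourSquaresWith form₁₂₂₂ (sq4 x y z t) (+ 2 * x + + 3 * y)
2x+3y-as-form₁₂₂₂ x y z t 3∣ with 3∣y-z-t⇒y≡k*3+z+t y z t 3∣
... | k , refl = z + t + k , x , t + + 2 * k , z + + 2 * k , squares x z t k , linear x z t k
  where
  squares : ∀ x z t k →
    x * x + (k * + 3 + z + t) * (k * + 3 + z + t) + z * z + t * t ≡
    (z + t + k) * (z + t + k) + x * x + (t + + 2 * k) * (t + + 2 * k) + (z + + 2 * k) * (z + + 2 * k)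
  squares = solve-∀
  linear : ∀ x z t k →
    + 2 * x + + 3 * (k * + 3 + z + t) ≡ (z + t + k) + + 2 * x + + 2 * (t + + 2 * k) + + 2 * (z + + 2 * k)
  linear = solve-∀

3∣y-z-t-suffices : ∀ {f} (g : ℤ → ℤ → ℤ) →
  (∀ x y z t → + 3 ∣ y - z - t → FourSquaresWith f (sq4 x y z t) (g x y)) →
  ∀ {m n} x y z t → m ≡ sq4 x y z t → n ≡ g x y →
  (+ 3 ∣ y - z + t) ⊎ (+ 3 ∣ y + z - t) ⊎ (+ 3 ∣ y + z + t) ⊎ (+ 3 ∣ y - z - t) →
  FourSquaresWith f m n
3∣y-z-t-suffices {f} g represent x y z t m≡ n≡ 3∣signed with 3∣signed-sum⇒3∣y-z′-t′ y z t 3∣signed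
... | z′ , t′ , z′²≡z² , t′²≡t² , 3∣ =
  subst₂ (FourSquaresWith f) (sym (trans m≡ same-squares)) (sym n≡) (represent x y z′ t′ 3∣)
  where
  same-squares : sq4 x y z t ≡ sq4 x y z′ t′
  same-squares = sym (cong₂ (λ a b → x * x + y * y + a + b) z′²≡z² t′²≡t²)

lemma3p3 : (m n : ℕ) →
    ((x y z t : ℤ) → + m ≡ sq4 x y z t → + n ≡ x + + 3 * y →
      (+ 3 ∣ y - z + t) ⊎ (+ 3 ∣ y + z - t) ⊎ (+ 3 ∣ y + z + t) ⊎ (+ 3 ∣ y - z - t) →
      ∃[ x' ] ∃[ y' ] ∃[ z' ] ∃[ t' ] (+ m ≡ sq4 x' y' z' t' × + n ≡ x' + y' + + 2 * z' + + 2 * t'))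
    × ((x y z t : ℤ) → + m ≡ sq4 x y z t → + n ≡ + 2 * x + + 3 * y →
      (+ 3 ∣ y - z + t) ⊎ (+ 3 ∣ y + z - t) ⊎ (+ 3 ∣ y + z + t) ⊎ (+ 3 ∣ y - z - t) →
      ∃[ x' ] ∃[ y' ] ∃[ z' ] ∃[ t' ] (+ m ≡ sq4 x' y' z' t' × + n ≡ x' + + 2 * y' + + 2 * z' + + 2 * t'))
lemma3p3 m n =
  3∣y-z-t-suffices (λ x y → x + + 3 * y) x+3y-as-form₁₁₂₂ ,
  3∣y-z-t-suffices (λ x y → + 2 * x + + 3 * y) 2x+3y-as-form₁₂₂₂
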